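{- Let $\pi\in S_n$ avoid $312$ and let $i<j$ be indices of $\pi$. (i) If $\pi_i>\pi_j$, then the entry $\pi_i$ appears before the entry $\pi_j$ in $\mathrm{swr}(\pi)$. (ii) If $\pi_i<\pi_j$, then the entry $\pi_i$ appears after the entry $\pi_j$ in $\mathrm{swr}(\pi)$ if and only if there exists $k>j$ such that $\pi_i<\pi_k<\pi_j$ (i.e. $(\pi_i,\pi_j,\pi_k)$ matches the pattern $132$).
   Context: $\pi$ avoids $312$ if there are no indices $a<b<c$ with $\pi_b<\pi_c<\pi_a$. For $h\in[n]$, let $m$ be the index with $\pi_m=h$, let $B$ (resp. $T$) be the subsequence of $\pi_1\cdots\pi_{m-1}$ consisting of entries less than (resp. greater than) $h$, and set $\mathrm{swr}_h(\pi)=T\,B\,\pi_m\pi_{m+1}\cdots\pi_n$ (concatenation). Define $\mathrm{swr}(\pi)=\mathrm{swr}_1\circ\mathrm{swr}_2\circ\cdots\circ\mathrm{swr}_n(\pi)$. -}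

module Defs where

open import Data.Nat using (ℕ; zero; suc; _<_; _<?_; _≟_)
open import Data.List using (List; []; _∷_; _++_; filter; length; lookup; applyUpTo)
open import Data.Fin using (Fin) renaming (_<_ to _<ᶠ_)
open import Data.Product using (_×_; _,_; ∃-syntax)
open import Relation.Nullary using (¬_; yes; no)
open import Relation.Binary.PropositionalEquality using (_≡_)
open import Data.List.Relation.Binary.Permutation.Propositional using (_↭_)

oneTo : ℕ → List ℕ
oneTo n = applyUpTo suc n

-- π (one-line notation, values in {1..n}) is a permutation in S_n
IsPerm : ℕ → List ℕ → Set
IsPerm n π = π ↭ oneTo n

Avoids312 : List ℕ → Set
Avoids312 π = ∀ (a b c : Fin (length π)) → a <ᶠ b → b <ᶠ c →
  ¬ (lookup π b < lookup π c × lookup π c < lookup π a)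

breakAt : ℕ → List ℕ → List ℕ × List ℕ
breakAt h [] = [] , []
breakAt h (x ∷ xs) with x ≟ h
... | yes _ = [] , x ∷ xs
... | no _ with breakAt h xs
...   | (p , r) = x ∷ p , r

-- swr_h(π) = T B π_m π_{m+1} ... π_n
swrH : ℕ → List ℕ → List ℕ
swrH h π with breakAt h π
... | (pre , rest) = filter (h <?_) pre ++ filter (_<? h) pre ++ rest

-- swrUpTo k = swr_1 ∘ swr_2 ∘ ... ∘ swr_k
swrUpTo : ℕ → List ℕ → List ℕ
swrUpTo zero π = π
swrUpTo (suc k) π = swrUpTo k (swrH (suc k) π)

swr : ℕ → List ℕ → List ℕ
swr n π = swrUpTo n π

AppearsBefore : List ℕ → ℕ → ℕ → Set
AppearsBefore σ a b = ∃[ p ] ∃[ q ] (lookup σ p ≡ a × lookup σ q ≡ b × p <ᶠ q)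

-- Write "a precedes b in σ" for the relative order of two entries of a list.
-- A single step swr_h keeps every such order except one kind: if a < h < b
-- and a precedes b, both lying before h, then swr_h moves b (in T) in front
-- of a (in B).  Moreover, if x < h < y both precede h, then y precedes x
-- after swr_h.  Iterating h = k, k-1, …, 1 gives three facts:
--   * an inversion (larger entry first) survives every step;
--   * if x < h < y all occur and x, y both precede h, then y precedes x in
--     the end (steps above h leave x, y in front of h, step h inverts them);
--   * if x < y, x precedes y, and y ends up in front of x, then some c with
--     x < c < y is preceded by y in the original list.
-- Part (i) is the first fact; part (ii) is the second and third, reading
-- "y precedes c" as "c sits at a position k > j".  None of this uses
-- 312-avoidance, so the theorem holds for every permutation.
module Submission where

open import Defs
open import Data.Nat using (ℕ; _<_; _>_)
open import Data.List using (List; length; lookup)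
open import Data.Fin using (Fin) renaming (_<_ to _<ᶠ_; _>_ to _>ᶠ_)
open import Data.Product using (_×_; ∃-syntax)
open import Function.Bundles using (_⇔_)

open import Data.Nat using (zero; suc; _≤_; _<?_; _≟_; z≤n; s≤s)
open import Data.Nat.Properties
  using (<-cmp; <-trans; <-asym; ≤-refl; <⇒≢; suc-injective; m<n⇒m<1+n; m≤n⇒m<n∨m≡n; ≤-pred)
open import Data.List using ([]; _∷_; _++_; filter)
open import Data.List.Membership.Propositional using (_∈_)
open import Data.List.Membership.Propositional.Properties
  using (∈-filter⁺; ∈-++⁺ˡ; ∈-++⁺ʳ; ∈-++⁻; ∈-lookup; ∈-applyUpTo⁺; ∈-applyUpTo⁻)
open import Data.List.Relation.Unary.Any using (here; there; index)
open import Data.List.Relation.Unary.Any.Properties using (lookup-index)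
import Data.List.Relation.Unary.All as All
open import Data.List.Relation.Unary.AllPairs using (_∷_)
open import Data.List.Relation.Unary.Unique.Propositional using (Unique)
open import Data.List.Relation.Unary.Unique.Propositional.Properties using (applyUpTo⁺₁)
open import Data.List.Relation.Binary.Permutation.Propositional using (_↭_; ↭-refl; ↭-sym; ↭-trans; prep; ↭⇒↭ₛ)
open import Data.List.Relation.Binary.Permutation.Propositional.Properties using (shift; ∈-resp-↭)
open import Data.List.Relation.Binary.Permutation.Setoid.Properties using (Unique-resp-↭)
open import Data.Fin using (zero; suc; toℕ)
open import Data.Fin.Properties using (toℕ-injective)
open import Data.Product using (_,_; proj₁; proj₂; ∃)
open import Data.Sum using (_⊎_; inj₁; inj₂)
open import Data.Empty using (⊥; ⊥-elim)
open import Relation.Nullary using (yes; no)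
open import Relation.Unary using (Decidable)
open import Relation.Binary using (tri<; tri≈; tri>)
open import Relation.Binary.PropositionalEquality using (_≡_; _≢_; refl; sym; trans; cong; subst)
open import Relation.Binary.PropositionalEquality.Properties using (setoid)
open import Function.Bundles using (mk⇔)

module _ {A : Set} where

  data Precedes : List A → A → A → Set where
    at-head : ∀ {a b xs} → b ∈ xs → Precedes (a ∷ xs) a b
    in-tail : ∀ {x a b xs} → Precedes xs a b → Precedes (x ∷ xs) a b

  precedes-∈ : ∀ {σ a b} → Precedes σ a b → a ∈ σ × b ∈ σ
  precedes-∈ (at-head b∈) = here refl , there b∈
  precedes-∈ (in-tail p) with precedes-∈ p
  ... | a∈ , b∈ = there a∈ , there b∈

  precedes-++ˡ : ∀ {a b} us vs → Precedes us a b → Precedes (us ++ vs) a b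
  precedes-++ˡ (_ ∷ us) vs (at-head b∈) = at-head (∈-++⁺ˡ b∈)
  precedes-++ˡ (_ ∷ us) vs (in-tail p) = in-tail (precedes-++ˡ us vs p)

  precedes-++ʳ : ∀ {a b} us vs → Precedes vs a b → Precedes (us ++ vs) a b
  precedes-++ʳ [] vs p = p
  precedes-++ʳ (_ ∷ us) vs p = in-tail (precedes-++ʳ us vs p)

  precedes-across : ∀ {a b} us vs → a ∈ us → b ∈ vs → Precedes (us ++ vs) a b
  precedes-across (_ ∷ us) vs (here refl) b∈ = at-head (∈-++⁺ʳ us b∈)
  precedes-across (_ ∷ us) vs (there a∈) b∈ = in-tail (precedes-across us vs a∈ b∈)

  precedes-++⁻ : ∀ {a b} us vs → Precedes (us ++ vs) a b →
    Precedes us a b ⊎ (a ∈ us × b ∈ vs) ⊎ Precedes vs a b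
  precedes-++⁻ [] vs p = inj₂ (inj₂ p)
  precedes-++⁻ (_ ∷ us) vs (at-head b∈) with ∈-++⁻ us b∈
  ... | inj₁ b∈us = inj₁ (at-head b∈us)
  ... | inj₂ b∈vs = inj₂ (inj₁ (here refl , b∈vs))
  precedes-++⁻ (_ ∷ us) vs (in-tail p) with precedes-++⁻ us vs p
  ... | inj₁ q = inj₁ (in-tail q)
  ... | inj₂ (inj₁ (a∈ , b∈)) = inj₂ (inj₁ (there a∈ , b∈))
  ... | inj₂ (inj₂ q) = inj₂ (inj₂ q)

  precedes-filter : ∀ {P : A → Set} (P? : Decidable P) {a b} xs →
    Precedes xs a b → P a → P b → Precedes (filter P? xs) a b
  precedes-filter P? (x ∷ xs) (at-head b∈) Pa Pb with P? x
  ... | yes _ = at-head (∈-filter⁺ P? b∈ Pb)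
  ... | no ¬Pa = ⊥-elim (¬Pa Pa)
  precedes-filter P? (x ∷ xs) (in-tail p) Pa Pb with P? x
  ... | yes _ = in-tail (precedes-filter P? xs p Pa Pb)
  ... | no _ = precedes-filter P? xs p Pa Pb

  precedes-total : ∀ {a b} σ → a ∈ σ → b ∈ σ → a ≢ b → Precedes σ a b ⊎ Precedes σ b a
  precedes-total (_ ∷ xs) (here refl) (here refl) a≢b = ⊥-elim (a≢b refl)
  precedes-total (_ ∷ xs) (here refl) (there b∈) _ = inj₁ (at-head b∈)
  precedes-total (_ ∷ xs) (there a∈) (here refl) _ = inj₂ (at-head a∈)
  precedes-total (_ ∷ xs) (there a∈) (there b∈) a≢b with precedes-total xs a∈ b∈ a≢b
  ... | inj₁ p = inj₁ (in-tail p)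
  ... | inj₂ p = inj₂ (in-tail p)

  precedes-asym : ∀ {σ a b} → Unique σ → Precedes σ a b → Precedes σ b a → ⊥
  precedes-asym (a∉ ∷ _) (at-head _) (at-head a∈) = All.lookup a∉ a∈ refl
  precedes-asym (a∉ ∷ _) (at-head _) (in-tail q) = All.lookup a∉ (proj₂ (precedes-∈ q)) refl
  precedes-asym (b∉ ∷ _) (in-tail p) (at-head _) = All.lookup b∉ (proj₂ (precedes-∈ p)) refl
  precedes-asym (_ ∷ u) (in-tail p) (in-tail q) = precedes-asym u p q

appearsBefore⇒precedes : ∀ σ {a b} → AppearsBefore σ a b → Precedes σ a b
appearsBefore⇒precedes (_ ∷ xs) (zero , suc q , refl , refl , _) = at-head (∈-lookup q)
appearsBefore⇒precedes (_ ∷ xs) (suc p , suc q , a≡ , b≡ , s≤s p<q) =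
  in-tail (appearsBefore⇒precedes xs (p , q , a≡ , b≡ , p<q))

precedes⇒appearsBefore : ∀ {σ a b} → Precedes σ a b → AppearsBefore σ a b
precedes⇒appearsBefore (at-head b∈) = zero , suc (index b∈) , refl , sym (lookup-index b∈) , s≤s z≤n
precedes⇒appearsBefore (in-tail p) with precedes⇒appearsBefore p
... | i , j , a≡ , b≡ , i<j = suc i , suc j , a≡ , b≡ , s≤s i<j

later-position : ∀ σ (j : Fin (length σ)) {c} → Unique σ →
  Precedes σ (lookup σ j) c → c ≢ lookup σ j → ∃[ k ] (k >ᶠ j × lookup σ k ≡ c)
later-position σ j u p c≢ with precedes⇒appearsBefore p
... | _ , k , _ , σₖ≡c , _ with <-cmp (toℕ j) (toℕ k)
...   | tri< j<k _ _ = k , j<k , σₖ≡c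
...   | tri≈ _ j≡k _ = ⊥-elim (c≢ (trans (sym σₖ≡c) (cong (lookup σ) (sym (toℕ-injective j≡k)))))
...   | tri> _ _ k<j = ⊥-elim (precedes-asym u p (appearsBefore⇒precedes σ (k , j , σₖ≡c , refl , k<j)))

-- A single step swr_h

-- breakAt h σ = (prefix h σ , suffix h σ): σ is cut just before h, and
-- swrH h σ = T ++ B ++ suffix with T, B the entries of the prefix above
-- and below h.
prefix suffix : ℕ → List ℕ → List ℕ
prefix h σ = proj₁ (breakAt h σ)
suffix h σ = proj₂ (breakAt h σ)

above below : ℕ → List ℕ → List ℕ
above h σ = filter (h <?_) (prefix h σ)
below h σ = filter (_<? h) (prefix h σ)

prefix-++-suffix : ∀ h σ → prefix h σ ++ suffix h σ ≡ σ
prefix-++-suffix h [] = refl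
prefix-++-suffix h (x ∷ xs) with x ≟ h
... | yes _ = refl
... | no _ = cong (x ∷_) (prefix-++-suffix h xs)

prefix-≢ : ∀ h σ {y} → y ∈ prefix h σ → y ≢ h
prefix-≢ h (x ∷ xs) y∈ with x ≟ h
prefix-≢ h (x ∷ xs) (here refl) | no x≢h = x≢h
prefix-≢ h (x ∷ xs) (there y∈) | no _ = prefix-≢ h xs y∈

suffix-starts-with : ∀ h σ → h ∈ σ → ∃ λ r → suffix h σ ≡ h ∷ r
suffix-starts-with h (x ∷ xs) h∈ with x ≟ h
suffix-starts-with h (x ∷ xs) _ | yes refl = xs , refl
suffix-starts-with h (x ∷ xs) (here h≡x) | no x≢h = ⊥-elim (x≢h (sym h≡x))
suffix-starts-with h (x ∷ xs) (there h∈) | no _ = suffix-starts-with h xs h∈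

h∈suffix : ∀ h σ → h ∈ σ → h ∈ suffix h σ
h∈suffix h σ h∈ with suffix-starts-with h σ h∈
... | r , eq = subst (h ∈_) (sym eq) (here refl)

precedes-split : ∀ h σ {a b} → Precedes σ a b → Precedes (prefix h σ ++ suffix h σ) a b
precedes-split h σ {a} {b} = subst (λ s → Precedes s a b) (sym (prefix-++-suffix h σ))

precedes-unsplit : ∀ h σ {a b} → Precedes (prefix h σ ++ suffix h σ) a b → Precedes σ a b
precedes-unsplit h σ {a} {b} = subst (λ s → Precedes s a b) (prefix-++-suffix h σ)

sort-into-block : ∀ h σ {y} → y ∈ prefix h σ → (h < y × y ∈ above h σ) ⊎ (y < h × y ∈ below h σ)
sort-into-block h σ {y} y∈ with <-cmp y h
... | tri< y<h _ _ = inj₂ (y<h , ∈-filter⁺ (_<? h) y∈ y<h)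
... | tri≈ _ y≡h _ = ⊥-elim (prefix-≢ h σ y∈ y≡h)
... | tri> _ _ h<y = inj₁ (h<y , ∈-filter⁺ (h <?_) y∈ h<y)

partition-↭ : ∀ {P Q : ℕ → Set} (P? : Decidable P) (Q? : Decidable Q) ps rest →
  (∀ {y} → y ∈ ps → P y ⊎ Q y) → (∀ {y} → P y → Q y → ⊥) →
  filter P? ps ++ filter Q? ps ++ rest ↭ ps ++ rest
partition-↭ P? Q? [] rest _ _ = ↭-refl
partition-↭ P? Q? (x ∷ xs) rest covers disjoint with P? x | Q? x
... | yes Px | yes Qx = ⊥-elim (disjoint Px Qx)
... | yes _ | no _ = prep x (partition-↭ P? Q? xs rest (λ y∈ → covers (there y∈)) disjoint)
... | no _ | yes _ = ↭-trans (shift x (filter P? xs) (filter Q? xs ++ rest))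
                             (prep x (partition-↭ P? Q? xs rest (λ y∈ → covers (there y∈)) disjoint))
... | no ¬Px | no ¬Qx with covers (here refl)
...   | inj₁ Px = ⊥-elim (¬Px Px)
...   | inj₂ Qx = ⊥-elim (¬Qx Qx)

swrH-↭ : ∀ h σ → swrH h σ ↭ σ
swrH-↭ h σ = subst (swrH h σ ↭_) (prefix-++-suffix h σ)
  (partition-↭ (h <?_) (_<? h) (prefix h σ) (suffix h σ) side (λ h<y y<h → <-asym h<y y<h))
  where
  side : ∀ {y} → y ∈ prefix h σ → h < y ⊎ y < h
  side y∈ with sort-into-block h σ y∈
  ... | inj₁ (h<y , _) = inj₁ h<y
  ... | inj₂ (y<h , _) = inj₂ y<h

swrH-∈ : ∀ h σ {y} → y ∈ σ → y ∈ swrH h σ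
swrH-∈ h σ = ∈-resp-↭ (↭-sym (swrH-↭ h σ))

swrH-unique : ∀ h σ → Unique σ → Unique (swrH h σ)
swrH-unique h σ = Unique-resp-↭ (setoid ℕ) (↭⇒↭ₛ (↭-sym (swrH-↭ h σ)))

-- Order between two prefix entries after swr_h: kept, unless a < h < b
-- (then a goes to B and b to T).
step-on-prefix : ∀ h σ {a b} → Precedes (prefix h σ) a b →
  Precedes (swrH h σ) a b ⊎ (a < h × h < b)
step-on-prefix h σ {a} {b} p
  with sort-into-block h σ (proj₁ (precedes-∈ p)) | sort-into-block h σ (proj₂ (precedes-∈ p))
... | inj₁ (h<a , _) | inj₁ (h<b , _) =
  inj₁ (precedes-++ˡ (above h σ) _ (precedes-filter (h <?_) (prefix h σ) p h<a h<b))
... | inj₂ (a<h , _) | inj₂ (b<h , _) =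
  inj₁ (precedes-++ʳ (above h σ) _ (precedes-++ˡ (below h σ) _ (precedes-filter (_<? h) (prefix h σ) p a<h b<h)))
... | inj₁ (_ , a∈T) | inj₂ (_ , b∈B) = inj₁ (precedes-across (above h σ) _ a∈T (∈-++⁺ˡ b∈B))
... | inj₂ (a<h , _) | inj₁ (h<b , _) = inj₂ (a<h , h<b)

step-preserves : ∀ h σ {a b} → h ∈ σ → Precedes σ a b →
  Precedes (swrH h σ) a b ⊎ (a < h × h < b × Precedes σ b h)
step-preserves h σ h∈ p with precedes-++⁻ (prefix h σ) (suffix h σ) (precedes-split h σ p)
... | inj₂ (inj₂ q) = inj₁ (precedes-++ʳ (above h σ) _ (precedes-++ʳ (below h σ) _ q))
... | inj₂ (inj₁ (a∈P , b∈S)) with sort-into-block h σ a∈P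
...   | inj₁ (_ , a∈T) = inj₁ (precedes-across (above h σ) _ a∈T (∈-++⁺ʳ (below h σ) b∈S))
...   | inj₂ (_ , a∈B) = inj₁ (precedes-++ʳ (above h σ) _ (precedes-across (below h σ) _ a∈B b∈S))
step-preserves h σ h∈ p | inj₁ q with step-on-prefix h σ q
... | inj₁ q' = inj₁ q'
... | inj₂ (a<h , h<b) = inj₂ (a<h , h<b ,
  precedes-unsplit h σ (precedes-across (prefix h σ) _ (proj₂ (precedes-∈ q)) (h∈suffix h σ h∈)))

precedes-h⇒prefix : ∀ h σ {z} → Unique σ → Precedes σ z h → z ∈ prefix h σ
precedes-h⇒prefix h σ u p with suffix-starts-with h σ (proj₂ (precedes-∈ p))
... | r , S≡ with precedes-++⁻ (prefix h σ) (suffix h σ) (precedes-split h σ p)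
...   | inj₁ q = proj₁ (precedes-∈ q)
...   | inj₂ (inj₁ (z∈P , _)) = z∈P
...   | inj₂ (inj₂ q) = ⊥-elim (precedes-asym u h≺h h≺h)
  where
  -- h would occur twice: once heading the suffix and once after it
  h∈r : h ∈ r
  h∈r with subst (λ s → Precedes s _ h) S≡ q
  ... | at-head h∈ = h∈
  ... | in-tail q' = proj₂ (precedes-∈ q')
  h≺h : Precedes σ h h
  h≺h = precedes-unsplit h σ (precedes-++ʳ (prefix h σ) _ (subst (λ s → Precedes s h h) (sym S≡) (at-head h∈r)))

-- If x < h < y and both precede h, then swr_h puts y (in T) before x (in B).
step-inverts : ∀ h σ {x y} → Unique σ → x < h → h < y →
  Precedes σ x h → Precedes σ y h → Precedes (swrH h σ) y x
step-inverts h σ u x<h h<y x≺h y≺h =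
  precedes-across (above h σ) _ (∈-filter⁺ (h <?_) (precedes-h⇒prefix h σ u y≺h) h<y)
    (∈-++⁺ˡ (∈-filter⁺ (_<? h) (precedes-h⇒prefix h σ u x≺h) x<h))

step-reflects : ∀ h σ {b c} → Unique σ → h ∈ σ → Precedes (swrH h σ) b c →
  Precedes σ b c ⊎ (c < h × h < b × Precedes σ b h)
step-reflects h σ u h∈ p with precedes-∈ p
... | b∈ , c∈ with precedes-total σ (∈-resp-↭ (swrH-↭ h σ) b∈) (∈-resp-↭ (swrH-↭ h σ) c∈) b≢c
  where
  b≢c : _ ≢ _
  b≢c refl = precedes-asym (swrH-unique h σ u) p p
...   | inj₁ b≺c = inj₁ b≺c
...   | inj₂ c≺b with step-preserves h σ h∈ c≺b
...     | inj₁ c≺b' = ⊥-elim (precedes-asym (swrH-unique h σ u) p c≺b')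
...     | inj₂ exception = inj₂ exception

step-keeps-inversion : ∀ h σ {a b} → h ∈ σ → a < b → Precedes σ b a → Precedes (swrH h σ) b a
step-keeps-inversion h σ h∈ a<b b≺a with step-preserves h σ h∈ b≺a
... | inj₁ b≺a' = b≺a'
... | inj₂ (b<h , h<a , _) = ⊥-elim (<-asym a<b (<-trans b<h h<a))

step-keeps-below : ∀ h σ {a b} → h ∈ σ → b < h → Precedes σ a b → Precedes (swrH h σ) a b
step-keeps-below h σ h∈ b<h a≺b with step-preserves h σ h∈ a≺b
... | inj₁ a≺b' = a≺b'
... | inj₂ (_ , h<b , _) = ⊥-elim (<-asym b<h h<b)

-- The composite swr_1 ∘ … ∘ swr_k

-- σ contains 1, …, k.  This guarantees that swr_k acts on an entry that
-- occurs, and, since swr_k only rearranges, passes down to k-1.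
Contains1To : ℕ → List ℕ → Set
Contains1To k σ = ∀ m → m < k → suc m ∈ σ

top-∈ : ∀ k σ → Contains1To (suc k) σ → suc k ∈ σ
top-∈ k σ has = has k ≤-refl

contains-step : ∀ k σ → Contains1To (suc k) σ → Contains1To k (swrH (suc k) σ)
contains-step k σ has m m<k = swrH-∈ (suc k) σ (has m (m<n⇒m<1+n m<k))

swr-keeps-inversion : ∀ k σ {a b} → Contains1To k σ → a < b →
  Precedes σ b a → Precedes (swrUpTo k σ) b a
swr-keeps-inversion zero σ _ _ b≺a = b≺a
swr-keeps-inversion (suc k) σ has a<b b≺a =
  swr-keeps-inversion k (swrH (suc k) σ) (contains-step k σ has) a<b
    (step-keeps-inversion (suc k) σ (top-∈ k σ has) a<b b≺a)

-- A pattern x < h < y with x and y both before h (an occurrence of 132 or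
-- 312) ends with y before x: steps above h keep x, y in front of h, step h
-- inverts them, and the inversion then survives.
swr-inverts-pattern : ∀ k σ {x h y} → Unique σ → Contains1To k σ → x < h → h < y → h ≤ k →
  Precedes σ x h → Precedes σ y h → Precedes (swrUpTo k σ) y x
swr-inverts-pattern zero σ _ _ () _ z≤n _ _
swr-inverts-pattern (suc k) σ u has x<h h<y h≤k x≺h y≺h with m≤n⇒m<n∨m≡n h≤k
... | inj₂ refl =
  swr-keeps-inversion k (swrH (suc k) σ) (contains-step k σ has) (<-trans x<h h<y)
    (step-inverts (suc k) σ u x<h h<y x≺h y≺h)
... | inj₁ h<k+1 =
  swr-inverts-pattern k (swrH (suc k) σ) (swrH-unique (suc k) σ u) (contains-step k σ has)
    x<h h<y (≤-pred h<k+1)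
    (step-keeps-below (suc k) σ (top-∈ k σ has) h<k+1 x≺h)
    (step-keeps-below (suc k) σ (top-∈ k σ has) h<k+1 y≺h)

swr-inversion-witness : ∀ k σ {a b} → Unique σ → Contains1To k σ → a < b →
  Precedes σ a b → Precedes (swrUpTo k σ) b a → ∃ λ c → a < c × c < b × Precedes σ b c
swr-inversion-witness zero σ u _ _ a≺b b≺a = ⊥-elim (precedes-asym u a≺b b≺a)
swr-inversion-witness (suc k) σ u has a<b a≺b b≺a with step-preserves (suc k) σ (top-∈ k σ has) a≺b
... | inj₂ (a<h , h<b , b≺h) = suc k , a<h , h<b , b≺h
... | inj₁ a≺b' with swr-inversion-witness k (swrH (suc k) σ) (swrH-unique (suc k) σ u) (contains-step k σ has) a<b a≺b' b≺a
...   | c , a<c , c<b , b≺c' with step-reflects (suc k) σ u (top-∈ k σ has) b≺c'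
...     | inj₁ b≺c = c , a<c , c<b , b≺c
...     | inj₂ (c<h , h<b , b≺h) = suc k , <-trans a<c c<h , h<b , b≺h

perm-unique : ∀ n π → IsPerm n π → Unique π
perm-unique n π perm = Unique-resp-↭ (setoid ℕ) (↭⇒↭ₛ (↭-sym perm))
  (applyUpTo⁺₁ suc n (λ a<b _ sa≡sb → <⇒≢ a<b (suc-injective sa≡sb)))

perm-contains : ∀ n π → IsPerm n π → Contains1To n π
perm-contains n π perm m m<n = ∈-resp-↭ (↭-sym perm) (∈-applyUpTo⁺ suc m<n)

perm-≤ : ∀ n π {y} → IsPerm n π → y ∈ π → y ≤ n
perm-≤ n π perm y∈ with ∈-applyUpTo⁻ suc (∈-resp-↭ perm y∈)
... | m , m<n , refl = m<n

lemma5p2 : (n : ℕ) (π : List ℕ) → IsPerm n π → Avoids312 π →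
    (i j : Fin (length π)) → i <ᶠ j →
    ((lookup π i > lookup π j → AppearsBefore (swr n π) (lookup π i) (lookup π j))
    × (lookup π i < lookup π j →
        (AppearsBefore (swr n π) (lookup π j) (lookup π i)
          ⇔ (∃[ k ] (k >ᶠ j × lookup π i < lookup π k × lookup π k < lookup π j)))))
lemma5p2 n π perm _ i j i<j = inversion , non-inversion
  where
  u : Unique π
  u = perm-unique n π perm
  has : Contains1To n π
  has = perm-contains n π perm
  by-position : ∀ {p q} → p <ᶠ q → Precedes π (lookup π p) (lookup π q)
  by-position {p} {q} p<q = appearsBefore⇒precedes π (p , q , refl , refl , p<q)

  inversion : lookup π i > lookup π j → AppearsBefore (swr n π) (lookup π i) (lookup π j)
  inversion πj<πi = precedes⇒appearsBefore (swr-keeps-inversion n π has πj<πi (by-position i<j))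

  non-inversion : lookup π i < lookup π j →
    AppearsBefore (swr n π) (lookup π j) (lookup π i)
      ⇔ (∃[ k ] (k >ᶠ j × lookup π i < lookup π k × lookup π k < lookup π j))
  non-inversion πi<πj = mk⇔ only-by-132 by-132
    where
    only-by-132 : AppearsBefore (swr n π) (lookup π j) (lookup π i) →
      ∃[ k ] (k >ᶠ j × lookup π i < lookup π k × lookup π k < lookup π j)
    only-by-132 swapped
      with swr-inversion-witness n π u has πi<πj (by-position i<j) (appearsBefore⇒precedes _ swapped)
    ... | c , πi<c , c<πj , πj≺c with later-position π j u πj≺c (<⇒≢ c<πj)
    ...   | k , j<k , refl = k , j<k , πi<c , c<πj
    by-132 : ∃[ k ] (k >ᶠ j × lookup π i < lookup π k × lookup π k < lookup π j) →
      AppearsBefore (swr n π) (lookup π j) (lookup π i)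
    by-132 (k , j<k , πi<πk , πk<πj) = precedes⇒appearsBefore
      (swr-inverts-pattern n π u has πi<πk πk<πj (perm-≤ n π perm (∈-lookup k))
        (by-position (<-trans i<j j<k)) (by-position j<k))
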